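{- Let $\alpha=\frac{1+\sqrt5}{2}$. The only pairs $(x,y)$ of positive integers satisfying \[\alpha^{x+y}=\alpha^x+\alpha^y+1\] are $(1,3)$ and $(3,1)$. -}

module Defs where

open import Data.Nat using (ℕ; zero; suc)
open import Data.Integer using (ℤ; 0ℤ; 1ℤ) renaming (_+_ to _+ℤ_; _*_ to _*ℤ_)

-- The ring ℤ[α] where α = (1+√5)/2, i.e. α² = α + 1.
-- An element  a ∷ b  represents the real number  a + b·α.
-- Since 1 and α are linearly independent over ℚ, this representation is
-- exact: two elements are equal as real numbers iff their coefficients agree.
record ℤ[α] : Set where
  constructor _∷α_
  field
    re : ℤ
    im : ℤ

infixl 6 _⊕_
infixl 7 _⊗_
infixr 8 _^α_

_⊕_ : ℤ[α] → ℤ[α] → ℤ[α]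
(a ∷α b) ⊕ (c ∷α d) = (a +ℤ c) ∷α (b +ℤ d)

-- (a + bα)(c + dα) = ac + (ad + bc)α + bd α² = (ac + bd) + (ad + bc + bd)α
_⊗_ : ℤ[α] → ℤ[α] → ℤ[α]
(a ∷α b) ⊗ (c ∷α d) = (a *ℤ c +ℤ b *ℤ d) ∷α (a *ℤ d +ℤ b *ℤ c +ℤ b *ℤ d)

𝟙 : ℤ[α]
𝟙 = 1ℤ ∷α 0ℤ

α : ℤ[α]
α = 0ℤ ∷α 1ℤ

_^α_ : ℤ[α] → ℕ → ℤ[α]
z ^α zero = 𝟙
z ^α suc n = z ⊗ (z ^α n)

{-# OPTIONS --safe #-}
-- In ℤ[α] one has α^(n+1) = F(n) + F(n+1)·α, so comparing α-coefficients
-- turns the equation into F(x + y) = F(x) + F(y). Fibonacci numbers are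
-- strictly superadditive from index 2 on, so x = 1 or y = 1, and then
-- F(y + 1) = 1 + F(y) forces F(y - 1) = 1, i.e. y ∈ {2, 3}. The candidate
-- (1, 2) satisfies the α-part but fails the rational part: α³ = 1 + 2α.
module Submission where

open import Defs
open import Data.Nat using (ℕ; zero; suc; _+_; _≤_; _<_; _≥_; z≤n; s≤s; _≤′_; ≤′-refl; ≤′-step)
open import Data.Nat.Properties
open import Data.Integer using (+_; 0ℤ) renaming (_+_ to _+ℤ_)
import Data.Integer.Properties as ℤ
open import Data.Product using (_×_; _,_)
open import Data.Sum using (_⊎_; inj₁; inj₂)
import Data.Sum as Sum
open import Relation.Nullary using (contradiction)
open import Relation.Binary.PropositionalEquality
  using (_≡_; _≢_; refl; sym; trans; cong; cong₂; subst; module ≡-Reasoning)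
open import Function.Bundles using (_⇔_; mk⇔)

fib : ℕ → ℕ
fib zero          = 0
fib (suc zero)    = 1
fib (suc (suc n)) = fib n + fib (suc n)

fib-mono : ∀ {m n} → m ≤ n → fib m ≤ fib n
fib-mono m≤n = go (≤⇒≤′ m≤n)
  where
  fib-≤-suc : ∀ n → fib n ≤ fib (suc n)
  fib-≤-suc zero    = z≤n
  fib-≤-suc (suc n) = m≤n+m (fib (suc n)) (fib n)

  go : ∀ {m n} → m ≤′ n → fib m ≤ fib n
  go ≤′-refl                 = ≤-refl
  go {n = suc n} (≤′-step p) = ≤-trans (go p) (fib-≤-suc n)

fib-mono-< : ∀ {m n} → 2 ≤ m → m < n → fib m < fib n
fib-mono-< {suc (suc m)} (s≤s (s≤s z≤n)) m<n = begin-strict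
  fib (2 + m)               <⟨ +-monoˡ-≤ (fib (2 + m)) (fib-mono {1} {1 + m} (s≤s z≤n)) ⟩
  fib (1 + m) + fib (2 + m) ≤⟨ fib-mono m<n ⟩
  _                         ∎
  where open ≤-Reasoning

fib-superadditive : ∀ {m n} → 2 ≤ m → 2 ≤ n → fib m + fib n < fib (m + n)
fib-superadditive {m} {n} 2≤m@(s≤s (s≤s (z≤n {a}))) 2≤n = begin-strict
  fib m + fib n        <⟨ +-mono-<-≤ (fib-mono-< 2≤m m<1+k) (fib-mono (m≤n+m n a)) ⟩
  fib (suc k) + fib k  ≡⟨ +-comm (fib (suc k)) (fib k) ⟩
  fib (m + n)          ∎
  where
  open ≤-Reasoning
  k = a + n
  m<1+k : m < suc k
  m<1+k = s≤s (subst (_≤ k) (+-comm a 2) (+-monoʳ-≤ a 2≤n))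

fib≡1⇒ : ∀ {n} → fib n ≡ 1 → n ≡ 1 ⊎ n ≡ 2
fib≡1⇒ {1} _ = inj₁ refl
fib≡1⇒ {2} _ = inj₂ refl
fib≡1⇒ {suc (suc (suc n))} fib[n]≡1 =
  contradiction (subst (2 ≤_) fib[n]≡1 (fib-mono {3} {3 + n} (s≤s (s≤s (s≤s z≤n))))) (1+n≰n {1})

fib[1+n]≡1+fib[n]⇒ : ∀ {n} → 1 ≤ n → fib (1 + n) ≡ 1 + fib n → n ≡ 2 ⊎ n ≡ 3
fib[1+n]≡1+fib[n]⇒ {suc n} _ eq =
  Sum.map (cong suc) (cong suc) (fib≡1⇒ (+-cancelʳ-≡ (fib (suc n)) (fib n) 1 eq))

fib-additive⇒ : ∀ {x y} → 1 ≤ x → 1 ≤ y → fib (x + y) ≡ fib x + fib y →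
                x ≡ 1 × (y ≡ 2 ⊎ y ≡ 3) ⊎ y ≡ 1 × (x ≡ 2 ⊎ x ≡ 3)
fib-additive⇒ {1} _ 1≤y eq = inj₁ (refl , fib[1+n]≡1+fib[n]⇒ 1≤y eq)
fib-additive⇒ {suc (suc a)} {1} 1≤x _ eq =
  inj₂ (refl , fib[1+n]≡1+fib[n]⇒ 1≤x
         (trans (cong fib (+-comm 1 (2 + a))) (trans eq (+-comm (fib (2 + a)) 1))))
fib-additive⇒ {suc (suc a)} {suc (suc b)} _ _ eq =
  contradiction eq (>⇒≢ (fib-superadditive {2 + a} {2 + b} (s≤s (s≤s z≤n)) (s≤s (s≤s z≤n))))

α⊗ : ∀ p q → α ⊗ (p ∷α q) ≡ q ∷α (p +ℤ q)
α⊗ p q rewrite ℤ.*-identityˡ p | ℤ.*-identityˡ q | ℤ.+-identityˡ p | ℤ.+-identityˡ q = refl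

α^suc≡fib : ∀ n → α ^α suc n ≡ (+ fib n) ∷α (+ fib (suc n))
α^suc≡fib zero    = refl
α^suc≡fib (suc n) = trans (cong (α ⊗_) (α^suc≡fib n)) (α⊗ (+ fib n) (+ fib (suc n)))

im-α^ : ∀ n → ℤ[α].im (α ^α n) ≡ + fib n
im-α^ zero    = refl
im-α^ (suc n) = cong ℤ[α].im (α^suc≡fib n)

α-equation⇒fib-additive : ∀ x y → α ^α (x + y) ≡ α ^α x ⊕ α ^α y ⊕ 𝟙 →
                          fib (x + y) ≡ fib x + fib y
α-equation⇒fib-additive x y eq = ℤ.+-injective (begin
  + fib (x + y)                      ≡⟨ sym (im-α^ (x + y)) ⟩
  im (α ^α (x + y))                  ≡⟨ cong im eq ⟩
  im (α ^α x) +ℤ im (α ^α y) +ℤ 0ℤ   ≡⟨ ℤ.+-identityʳ _ ⟩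
  im (α ^α x) +ℤ im (α ^α y)         ≡⟨ cong₂ _+ℤ_ (im-α^ x) (im-α^ y) ⟩
  + fib x +ℤ + fib y                 ∎)
  where
  open ≡-Reasoning
  open ℤ[α] using (im)

α³≢α+α²+1 : α ^α 3 ≢ α ^α 1 ⊕ α ^α 2 ⊕ 𝟙
α³≢α+α²+1 ()

lemma3 : (x y : ℕ) → x ≥ 1 → y ≥ 1 →
    ((α ^α (x + y) ≡ α ^α x ⊕ α ^α y ⊕ 𝟙) ⇔ ((x ≡ 1 × y ≡ 3) ⊎ (x ≡ 3 × y ≡ 1)))
lemma3 x y x≥1 y≥1 = mk⇔ to from
  where
  to : α ^α (x + y) ≡ α ^α x ⊕ α ^α y ⊕ 𝟙 → (x ≡ 1 × y ≡ 3) ⊎ (x ≡ 3 × y ≡ 1)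
  to eq with fib-additive⇒ x≥1 y≥1 (α-equation⇒fib-additive x y eq)
  ... | inj₁ (refl , inj₁ refl) = contradiction eq α³≢α+α²+1
  ... | inj₁ (refl , inj₂ refl) = inj₁ (refl , refl)
  ... | inj₂ (refl , inj₁ refl) = contradiction eq α³≢α+α²+1
  ... | inj₂ (refl , inj₂ refl) = inj₂ (refl , refl)

  from : (x ≡ 1 × y ≡ 3) ⊎ (x ≡ 3 × y ≡ 1) → α ^α (x + y) ≡ α ^α x ⊕ α ^α y ⊕ 𝟙
  from (inj₁ (refl , refl)) = refl
  from (inj₂ (refl , refl)) = refl
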